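{- For all formulas $\varphi,\psi$ of $\mathcal{L}(\nabla,\bullet)$, the formula $\bullet\psi\to(\Box\varphi\leftrightarrow\Delta\varphi\land\circ(\neg\psi\to\varphi))$ is valid, i.e. true at every state of every Kripke model.
   Context: Fix a nonempty set $\mathbf{P}$ of propositional variables. Formulas are generated by $\varphi::=p\mid\neg\varphi\mid\varphi\land\varphi\mid\nabla\varphi\mid\bullet\varphi\mid\Diamond\varphi$ ($p\in\mathbf{P}$); the language $\mathcal{L}(\nabla,\bullet)$ is the fragment without $\Diamond$. Abbreviations: $\Delta\varphi:=\neg\nabla\varphi$, $\circ\varphi:=\neg\bullet\varphi$, $\Box\varphi:=\neg\Diamond\neg\varphi$. A model is $\mathcal{M}=\langle S,R,V\rangle$ with $S$ nonempty, $R\subseteq S\times S$, $V:\mathbf{P}\to\mathcal{P}(S)$. Truth: $\mathcal{M},s\vDash p$ iff $s\in V(p)$; Booleans as usual; $\mathcal{M},s\vDash\nabla\varphi$ iff there are $t,u$ with $sRt$, $sRu$, $\mathcal{M},t\vDash\varphi$, $\mathcal{M},u\nvDash\varphi$; $\mathcal{M},s\vDash\bullet\varphi$ iff $\mathcal{M},s\vDash\varphi$ and some $t$ with $sRt$ has $\mathcal{M},t\nvDash\varphi$; $\mathcal{M},s\vDash\Diamond\varphi$ iff some $t$ with $sRt$ has $\mathcal{M},t\vDash\varphi$. -}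

module Defs where

open import Data.Product using (_×_; Σ; ∃; _,_)
open import Relation.Nullary using (¬_)
open import Data.Unit using (⊤)
open import Data.Empty using (⊥)

data Form (P : Set) : Set where
  var  : P → Form P
  ¬'_  : Form P → Form P
  _∧'_ : Form P → Form P → Form P
  ∇_   : Form P → Form P
  •_   : Form P → Form P
  ◇_   : Form P → Form P

infixr 6 _∧'_
infix 7 ¬'_ ∇_ •_ ◇_

module _ {P : Set} where
  Δ_ : Form P → Form P
  Δ φ = ¬' (∇ φ)

  ∘_ : Form P → Form P
  ∘ φ = ¬' (• φ)

  □_ : Form P → Form P
  □ φ = ¬' (◇ (¬' φ))

  _∨'_ : Form P → Form P → Form P
  φ ∨' ψ = ¬' (¬' φ ∧' ¬' ψ)

  _→'_ : Form P → Form P → Form P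
  φ →' ψ = ¬' (φ ∧' ¬' ψ)

  _↔'_ : Form P → Form P → Form P
  φ ↔' ψ = (φ →' ψ) ∧' (ψ →' φ)

  infix 7 Δ_ ∘_ □_
  infixr 5 _∨'_
  infixr 4 _→'_
  infix 3 _↔'_

  InL∇• : Form P → Set
  InL∇• (var p)  = ⊤
  InL∇• (¬' φ)   = InL∇• φ
  InL∇• (φ ∧' ψ) = InL∇• φ × InL∇• ψ
  InL∇• (∇ φ)    = InL∇• φ
  InL∇• (• φ)    = InL∇• φ
  InL∇• (◇ φ)    = ⊥

record Model (P : Set) : Set₁ where
  field
    S : Set
    s₀ : S            -- S is nonempty
    R : S → S → Set
    V : P → S → Set

open Model public

module _ {P : Set} (M : Model P) where
  _,_⊨_ : S M → Form P → Set
  _,_⊨_ s (var p)  = V M p s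
  _,_⊨_ s (¬' φ)   = ¬ (_,_⊨_ s φ)
  _,_⊨_ s (φ ∧' ψ) = _,_⊨_ s φ × _,_⊨_ s ψ
  _,_⊨_ s (∇ φ)    = Σ (S M) λ t → Σ (S M) λ u →
                       R M s t × R M s u × _,_⊨_ t φ × ¬ (_,_⊨_ u φ)
  _,_⊨_ s (• φ)    = _,_⊨_ s φ × Σ (S M) λ t → R M s t × ¬ (_,_⊨_ t φ)
  _,_⊨_ s (◇ φ)    = Σ (S M) λ t → R M s t × _,_⊨_ t φ

Valid : {P : Set} → Form P → Set₁
Valid {P} φ = (M : Model P) → (s : S M) → _,_⊨_ M s φ

-- A state satisfying •ψ has a successor t₀ refuting ψ. If □φ fails at a
-- successor u, then either φ already varies among the successors (so Δφ
-- fails) or it fails at t₀ too, and then t₀ refutes ¬ψ → φ while the state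
-- itself satisfies it through ψ (so ∘(¬ψ → φ) fails). Conversely □φ makes φ,
-- hence ¬ψ → φ, true at every successor. The argument is intuitionistic and
-- holds for arbitrary formulas.
module Submission where

open import Defs
open import Level using (0ℓ)
open import Axiom.ExcludedMiddle using (ExcludedMiddle)
open import Data.Product using (_,_)
open import Relation.Nullary using (¬_)

module _ {P : Set} (M : Model P) where

  ⊨-→'-intro : ∀ {s} {φ ψ : Form P} →
    (_,_⊨_ M s φ → _,_⊨_ M s ψ) → _,_⊨_ M s (φ →' ψ)
  ⊨-→'-intro f (sφ , ¬sψ) = ¬sψ (f sφ)

  ⊨-↔'-intro : ∀ {s} {φ ψ : Form P} →
    (_,_⊨_ M s φ → _,_⊨_ M s ψ) → (_,_⊨_ M s ψ → _,_⊨_ M s φ) →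
    _,_⊨_ M s (φ ↔' ψ)
  ⊨-↔'-intro {φ = φ} {ψ} f g = ⊨-→'-intro {φ = φ} {ψ} f , ⊨-→'-intro {φ = ψ} {φ} g

  □⇒Δ : ∀ {s} {φ : Form P} → _,_⊨_ M s (□ φ) → _,_⊨_ M s (Δ φ)
  □⇒Δ □φ (_ , u , _ , su , _ , ¬uφ) = □φ (u , su , ¬uφ)

  □⇒∘ : ∀ {s} {φ χ : Form P} → (∀ t → _,_⊨_ M t φ → _,_⊨_ M t χ) →
    _,_⊨_ M s (□ φ) → _,_⊨_ M s (∘ χ)
  □⇒∘ φ⇒χ □φ (_ , t , st , ¬tχ) = □φ (t , st , λ tφ → ¬tχ (φ⇒χ t tφ))

  ⊨-→'-weaken : ∀ {t} {φ ψ : Form P} → _,_⊨_ M t φ → _,_⊨_ M t (ψ →' φ)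
  ⊨-→'-weaken {φ = φ} {ψ} tφ = ⊨-→'-intro {φ = ψ} {φ} λ _ → tφ

  •Δ∘⇒□ : ∀ {s} {φ ψ : Form P} → _,_⊨_ M s (• ψ) →
    _,_⊨_ M s (Δ φ) → _,_⊨_ M s (∘ ((¬' ψ) →' φ)) → _,_⊨_ M s (□ φ)
  •Δ∘⇒□ {s} {φ} {ψ} (sψ , t₀ , st₀ , ¬t₀ψ) Δφ ∘χ (u , su , ¬uφ) =
    ∘χ (sχ , t₀ , st₀ , λ t₀χ → t₀χ (¬t₀ψ , ¬t₀φ))
    where
    sχ : _,_⊨_ M s ((¬' ψ) →' φ)
    sχ (¬sψ , _) = ¬sψ sψ
    ¬t₀φ : ¬ _,_⊨_ M t₀ φ
    ¬t₀φ t₀φ = Δφ (t₀ , u , st₀ , su , t₀φ , ¬uφ)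

mainTheorem2 : ExcludedMiddle 0ℓ → (P : Set) → P → (φ ψ : Form P) →
    InL∇• φ → InL∇• ψ →
    Valid ((• ψ) →' ((□ φ) ↔' ((Δ φ) ∧' (∘ ((¬' ψ) →' φ)))))
mainTheorem2 _ P _ φ ψ _ _ M s = ⊨-→'-intro M {φ = • ψ} {□ φ ↔' Δ φ ∧' ∘ χ} λ •ψ →
  ⊨-↔'-intro M {φ = □ φ} {Δ φ ∧' ∘ χ}
    (λ □φ → □⇒Δ M {φ = φ} □φ , □⇒∘ M {φ = φ} {χ} (λ _ → ⊨-→'-weaken M {φ = φ} {¬' ψ}) □φ)
    (λ (Δφ , ∘χ) → •Δ∘⇒□ M {φ = φ} {ψ} •ψ Δφ ∘χ)
  where
  χ : Form P
  χ = (¬' ψ) →' φ
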